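{- Let $G$ be a triangle-free graph of order $n\ge 2$. Then $PC(G)=n$ if and only if $G$ is a complete bipartite graph.
   Context: A graph is triangle-free if it has no $K_3$ as an (induced) subgraph. A paired dominating set of $G$ is a dominating set $S$ such that $G[S]$ has a perfect matching. Two disjoint sets form a paired coalition if neither is a paired dominating set but their union is. A $pc$-partition of $G$ is a partition of $V(G)$ into nonempty sets, none a paired dominating set, each forming a paired coalition with some other set of the partition. $PC(G)$ is the maximum number of sets in a $pc$-partition ($0$ if none exists). -}

module Defs where

open import Data.Nat using (ℕ; _≤_)
open import Data.Fin using (Fin; _≟_)
open import Data.Bool using (Bool; true; false; _∨_)
open import Data.Product using (Σ; ∃; ∃-syntax; _×_; _,_)
open import Data.Sum using (_⊎_)
open import Relation.Binary.PropositionalEquality using (_≡_; _≢_)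
open import Relation.Nullary using (¬_; does)
open import Function.Bundles using (_⇔_)

record Graph (n : ℕ) : Set where
  field
    adj   : Fin n → Fin n → Bool
    sym   : ∀ u v → adj u v ≡ adj v u
    irrefl : ∀ v → adj v v ≡ false
open Graph public

VSet : ℕ → Set
VSet n = Fin n → Bool

_∈_ : ∀ {n} → Fin n → VSet n → Set
v ∈ S = S v ≡ true

_∪_ : ∀ {n} → VSet n → VSet n → VSet n
(S ∪ T) v = S v ∨ T v

Adj : ∀ {n} → Graph n → Fin n → Fin n → Set
Adj G u v = adj G u v ≡ true

TriangleFree : ∀ {n} → Graph n → Set
TriangleFree G = ∀ u v w → ¬ (Adj G u v × Adj G v w × Adj G u w)

Dominating : ∀ {n} → Graph n → VSet n → Set
Dominating G S = ∀ v → v ∈ S ⊎ (∃[ u ] (u ∈ S × Adj G v u))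

-- G[S] has a perfect matching: a partner map on S which is a fixed-point-free
-- involution of S along edges of G (each vertex of S matched to exactly one
-- vertex of S by an edge).
HasPerfectMatching : ∀ {n} → Graph n → VSet n → Set
HasPerfectMatching {n} G S =
  Σ (Fin n → Fin n) λ m →
    ∀ v → v ∈ S → (m v ∈ S) × Adj G v (m v) × (m (m v) ≡ v)

PairedDominating : ∀ {n} → Graph n → VSet n → Set
PairedDominating G S = Dominating G S × HasPerfectMatching G S

part : ∀ {n k} → (Fin n → Fin k) → Fin k → VSet n
part f i v = does (f v ≟ i)

PairedCoalition : ∀ {n} → Graph n → VSet n → VSet n → Set
PairedCoalition G S T =
  (∀ v → ¬ (v ∈ S × v ∈ T)) ×
  ¬ PairedDominating G S × ¬ PairedDominating G T × PairedDominating G (S ∪ T)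

IsPCPartition : ∀ {n} → Graph n → (k : ℕ) → (Fin n → Fin k) → Set
IsPCPartition {n} G k f =
  (∀ i → ∃[ v ] (v ∈ part f i)) ×
  (∀ i → ¬ PairedDominating G (part f i)) ×
  (∀ i → ∃[ j ] (j ≢ i × PairedCoalition G (part f i) (part f j)))

HasPCPartition : ∀ {n} → Graph n → ℕ → Set
HasPCPartition {n} G k = Σ (Fin n → Fin k) (IsPCPartition G k)

-- PC(G) ≡ m : m is the maximum size of a pc-partition, or 0 if none exists
PCis : ∀ {n} → Graph n → ℕ → Set
PCis G m =
  (HasPCPartition G m × (∀ k → HasPCPartition G k → k ≤ m)) ⊎
  ((m ≡ 0) × (∀ k → ¬ HasPCPartition G k))

CompleteBipartite : ∀ {n} → Graph n → Set
CompleteBipartite {n} G =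
  Σ (VSet n) λ A →
    (∃[ a ] (A a ≡ true)) × (∃[ b ] (A b ≡ false)) ×
    (∀ u v → Adj G u v ⇔ (A u ≢ A v))

-- A pc-partition has nonempty parts, so it has at most n of them, and one with exactly n parts
-- consists of singletons. A singleton is never paired dominating, and {v} ∪ {w} is paired dominating
-- exactly when vw is a dominating edge (every vertex is adjacent to v or to w). Hence, in any graph,
-- PC(G) = n iff every vertex lies on a dominating edge.
-- In a triangle-free graph the endpoints of a dominating edge v₀w₀ have complementary neighbourhoods,
-- so N(w₀) and N(v₀) split the vertices into two sides without inner edges. A vertex u is adjacent to
-- every x on the other side: x is on the side of u's own dominating-edge partner w, so x ≁ w and
-- hence x ~ u.
module Submission where

open import Defs
open import Data.Nat using (ℕ; _≤_; suc; s≤s)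
open import Data.Nat.Properties using (1+n≰n)
open import Data.Fin using (Fin; zero; _≟_; punchOut)
open import Data.Fin.Properties using (any?; injective⇒≤; punchOut-injective)
open import Data.Fin.Permutation.Components using (transpose)
open import Data.Bool using (true; false; not)
import Data.Bool as Bool
open import Data.Bool.Properties using (∨-zeroʳ; not-¬; ¬-not)
open import Data.Product using (∃-syntax; _×_; _,_; proj₁; proj₂)
open import Data.Sum using (_⊎_; inj₁; inj₂)
open import Function using (id; _∘_)
open import Function.Bundles using (_⇔_; mk⇔; Equivalence)
open import Function.Construct.Composition using (_⇔-∘_)
open import Function.Definitions using (Injective)
open import Relation.Nullary using (¬_; yes; no; contradiction)
open import Relation.Nullary.Decidable using (dec-true; dec-false)
open import Relation.Binary.PropositionalEquality as ≡ using (_≡_; _≢_; refl; cong; ≢-sym)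
open ≡.≡-Reasoning

∈-part : ∀ {n k} (f : Fin n → Fin k) v → v ∈ part f (f v)
∈-part f v = dec-true (f v ≟ f v) refl

∈-part⁻ : ∀ {n k} (f : Fin n → Fin k) {i} v → v ∈ part f i → f v ≡ i
∈-part⁻ f {i} v v∈ with f v ≟ i
∈-part⁻ f v v∈ | yes fv≡i = fv≡i

x∈S∪T⁺ : ∀ {n} (S T : VSet n) {v} → v ∈ S ⊎ v ∈ T → v ∈ (S ∪ T)
x∈S∪T⁺ S T (inj₁ v∈S) rewrite v∈S = refl
x∈S∪T⁺ S T {v} (inj₂ v∈T) rewrite v∈T = ∨-zeroʳ (S v)

x∈S∪T⁻ : ∀ {n} (S T : VSet n) {v} → v ∈ (S ∪ T) → v ∈ S ⊎ v ∈ T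
x∈S∪T⁻ S T {v} v∈S∪T with S v
... | true = inj₁ refl
... | false = inj₂ v∈S∪T

transpose-atˡ : ∀ {n} (i j : Fin n) → transpose i j i ≡ j
transpose-atˡ i j rewrite dec-true (i ≟ i) refl = refl

transpose-atʳ : ∀ {n} {i j : Fin n} → j ≢ i → transpose i j j ≡ i
transpose-atʳ {i = i} {j} j≢i rewrite dec-false (j ≟ i) j≢i | dec-true (j ≟ j) refl = refl

injective⇒surjective : ∀ {n} {g : Fin n → Fin n} → Injective _≡_ _≡_ g → ∀ x → ∃[ a ] g a ≡ x
injective⇒surjective {suc n} {g} g-injective x with any? (λ a → g a ≟ x)
... | yes hit = hit
... | no miss = contradiction (injective⇒≤ punchOut∘g-injective) 1+n≰n
  where
  x≢g : ∀ a → x ≢ g a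
  x≢g a x≡ga = miss (a , ≡.sym x≡ga)

  punchOut∘g : Fin (suc n) → Fin n
  punchOut∘g a = punchOut (x≢g a)

  punchOut∘g-injective : Injective _≡_ _≡_ punchOut∘g
  punchOut∘g-injective = g-injective ∘ punchOut-injective (x≢g _) (x≢g _)

module _ {n k} (f : Fin n → Fin k) (nonempty : ∀ i → ∃[ v ] v ∈ part f i) where

  representative : Fin k → Fin n
  representative i = proj₁ (nonempty i)

  f∘representative : ∀ i → f (representative i) ≡ i
  f∘representative i = ∈-part⁻ f (representative i) (proj₂ (nonempty i))

  representative-injective : Injective _≡_ _≡_ representative
  representative-injective {i} {j} ri≡rj = begin
    i                      ≡⟨ f∘representative i ⟨
    f (representative i)   ≡⟨ cong f ri≡rj ⟩
    f (representative j)   ≡⟨ f∘representative j ⟩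
    j                      ∎

  nonemptyParts⇒≤ : k ≤ n
  nonemptyParts⇒≤ = injective⇒≤ representative-injective

-- By pigeonhole the n representatives exhaust the n vertices, so they form a two-sided inverse of f.
nonemptyParts⇒injective : ∀ {n} (f : Fin n → Fin n) → (nonempty : ∀ i → ∃[ v ] v ∈ part f i) →
                          Injective _≡_ _≡_ f
nonemptyParts⇒injective f nonempty {u} {v} fu≡fv = begin
  u                 ≡⟨ r∘f u ⟨
  r (f u)           ≡⟨ cong r fu≡fv ⟩
  r (f v)           ≡⟨ r∘f v ⟩
  v                 ∎
  where
  r : Fin _ → Fin _
  r = representative f nonempty

  r∘f : ∀ u → r (f u) ≡ u
  r∘f u with a , ra≡u ← injective⇒surjective (representative-injective f nonempty) u = begin
    r (f u)         ≡⟨ cong (r ∘ f) ra≡u ⟨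
    r (f (r a))     ≡⟨ cong r (f∘representative f nonempty a) ⟩
    r a             ≡⟨ ra≡u ⟩
    u               ∎

Adj-sym : ∀ {n} (G : Graph n) {u v} → Adj G u v → Adj G v u
Adj-sym G {u} {v} u~v = ≡.trans (sym G v u) u~v

Adj-irrefl : ∀ {n} (G : Graph n) {u v} → Adj G u v → u ≢ v
Adj-irrefl G {u} u~u refl with () ← ≡.trans (≡.sym u~u) (irrefl G u)

-- As v ~ w, "u ∈ {v, w} or u has a neighbour in {v, w}" reduces to its second clause.
DominatingEdge : ∀ {n} → Graph n → Fin n → Fin n → Set
DominatingEdge G v w = Adj G v w × (∀ u → Adj G u v ⊎ Adj G u w)

EveryVertexOnDominatingEdge : ∀ {n} → Graph n → Set
EveryVertexOnDominatingEdge G = ∀ v → ∃[ w ] DominatingEdge G v w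

singleton-¬PairedDominating : ∀ {n} (G : Graph n) v → ¬ PairedDominating G (part id v)
singleton-¬PairedDominating G v (_ , m , matched) with mv∈ , v~mv , _ ← matched v (∈-part id v) =
  Adj-irrefl G v~mv (≡.sym (∈-part⁻ id (m v) mv∈))

module _ {n} (G : Graph n) {v w : Fin n} where

  private
    pair : VSet n
    pair = part id v ∪ part id w

  dominatingEdge⇒pairedDominating : DominatingEdge G v w → PairedDominating G pair
  dominatingEdge⇒pairedDominating (v~w , covers) = dominating , transpose v w , matched
    where
    w≢v : w ≢ v
    w≢v = ≢-sym (Adj-irrefl G v~w)

    v∈ : v ∈ pair
    v∈ = x∈S∪T⁺ (part id v) (part id w) {v} (inj₁ (∈-part id v))

    w∈ : w ∈ pair
    w∈ = x∈S∪T⁺ (part id v) (part id w) {w} (inj₂ (∈-part id w))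

    dominating : Dominating G pair
    dominating u with covers u
    ... | inj₁ u~v = inj₂ (v , v∈ , u~v)
    ... | inj₂ u~w = inj₂ (w , w∈ , u~w)

    Matched : Fin n → Set
    Matched x = let y = transpose v w x in y ∈ pair × Adj G x y × transpose v w y ≡ x

    swappedWith : ∀ {x y} → transpose v w x ≡ y → transpose v w y ≡ x →
                  y ∈ pair → Adj G x y → Matched x
    swappedWith refl back y∈ x~y = y∈ , x~y , back

    matched : ∀ x → x ∈ pair → Matched x
    matched x x∈ with x∈S∪T⁻ (part id v) (part id w) {x} x∈
    ... | inj₁ x∈v with refl ← ∈-part⁻ id {v} x x∈v =
      swappedWith (transpose-atˡ v w) (transpose-atʳ w≢v) w∈ v~w
    ... | inj₂ x∈w with refl ← ∈-part⁻ id {w} x x∈w =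
      swappedWith (transpose-atʳ w≢v) (transpose-atˡ v w) v∈ (Adj-sym G v~w)

  dominatingEdge⇒pairedCoalition : DominatingEdge G v w → PairedCoalition G (part id v) (part id w)
  dominatingEdge⇒pairedCoalition edge@(v~w , _) =
    disjoint , singleton-¬PairedDominating G v , singleton-¬PairedDominating G w ,
    dominatingEdge⇒pairedDominating edge
    where
    disjoint : ∀ x → ¬ (x ∈ part id v × x ∈ part id w)
    disjoint x (x∈v , x∈w) =
      Adj-irrefl G v~w (≡.trans (≡.sym (∈-part⁻ id x x∈v)) (∈-part⁻ id x x∈w))

everyVertexOnDominatingEdge⇒pcPartition : ∀ {n} (G : Graph n) → EveryVertexOnDominatingEdge G →
                              IsPCPartition G n id
everyVertexOnDominatingEdge⇒pcPartition G edges =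
  (λ v → v , ∈-part id v) ,
  singleton-¬PairedDominating G ,
  λ v → let w , edge = edges v in
    w , ≢-sym (Adj-irrefl G (proj₁ edge)) , dominatingEdge⇒pairedCoalition G edge

pairedDominating⊆pair⇒dominatingEdge : ∀ {n} (G : Graph n) {S : VSet n} {v w} →
                                        PairedDominating G S → v ∈ S →
                                        (∀ x → x ∈ S → x ≡ v ⊎ x ≡ w) → DominatingEdge G v w
pairedDominating⊆pair⇒dominatingEdge G {S} {v} {w} (dominating , m , matched) v∈S ⊆vw =
  v~w , covers
  where
  v~w : Adj G v w
  v~w with mv∈S , v~mv , _ ← matched v v∈S | ⊆vw (m v) mv∈S
  ... | inj₁ mv≡v = contradiction (≡.sym mv≡v) (Adj-irrefl G v~mv)
  ... | inj₂ refl = v~mv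

  covers : ∀ u → Adj G u v ⊎ Adj G u w
  covers u with dominating u
  ... | inj₁ u∈S with ⊆vw u u∈S
  ...   | inj₁ refl = inj₂ v~w
  ...   | inj₂ refl = inj₁ (Adj-sym G v~w)
  covers u | inj₂ (x , x∈S , u~x) with ⊆vw x x∈S
  ...   | inj₁ refl = inj₁ u~x
  ...   | inj₂ refl = inj₂ u~x

pcPartition⇒everyVertexOnDominatingEdge : ∀ {n} (G : Graph n) (f : Fin n → Fin n) →
                                          IsPCPartition G n f →
                              EveryVertexOnDominatingEdge G
pcPartition⇒everyVertexOnDominatingEdge G f (nonempty , _ , coalition) v
  with j , _ , _ , _ , _ , pairedDominating ← coalition (f v) =
  w , pairedDominating⊆pair⇒dominatingEdge G pairedDominating v∈ ⊆vw
  where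
  w : Fin _
  w = representative f nonempty j

  v∈ : v ∈ (part f (f v) ∪ part f j)
  v∈ = x∈S∪T⁺ (part f (f v)) (part f j) {v} (inj₁ (∈-part f v))

  ⊆vw : ∀ x → x ∈ (part f (f v) ∪ part f j) → x ≡ v ⊎ x ≡ w
  ⊆vw x x∈ with x∈S∪T⁻ (part f (f v)) (part f j) {x} x∈
  ... | inj₁ x∈i = inj₁ (nonemptyParts⇒injective f nonempty (∈-part⁻ f x x∈i))
  ... | inj₂ x∈j = inj₂ (nonemptyParts⇒injective f nonempty
                           (≡.trans (∈-part⁻ f x x∈j) (≡.sym (f∘representative f nonempty j))))

PCis-n⇔everyVertexOnDominatingEdge : ∀ {n} (G : Graph n) → PCis G n ⇔ EveryVertexOnDominatingEdge G
PCis-n⇔everyVertexOnDominatingEdge G = mk⇔ onDominatingEdge pcIs-n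
  where
  onDominatingEdge : PCis G _ → EveryVertexOnDominatingEdge G
  onDominatingEdge (inj₁ ((f , pcPartition) , _)) =
    pcPartition⇒everyVertexOnDominatingEdge G f pcPartition
  onDominatingEdge (inj₂ (refl , _)) ()

  pcIs-n : EveryVertexOnDominatingEdge G → PCis G _
  pcIs-n edges = inj₁ ((id , everyVertexOnDominatingEdge⇒pcPartition G edges) ,
                       λ _ (f , nonempty , _) → nonemptyParts⇒≤ f nonempty)

completeBipartite⇒everyVertexOnDominatingEdge : ∀ {n} (G : Graph n) → CompleteBipartite G →
                                                EveryVertexOnDominatingEdge G
completeBipartite⇒everyVertexOnDominatingEdge G (A , (a , Aa) , (b , Ab) , adj⇔) v = w , v~w , covers
  where
  across : ∀ {u x} → A u ≢ A x → Adj G u x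
  across = Equivalence.from (adj⇔ _ _)

  opposite : ∀ c → ∃[ x ] A x ≡ not c
  opposite true = b , Ab
  opposite false = a , Aa

  w : Fin _
  w = proj₁ (opposite (A v))

  Aw≡¬Av : A w ≡ not (A v)
  Aw≡¬Av = proj₂ (opposite (A v))

  v~w : Adj G v w
  v~w = across λ Av≡Aw → not-¬ refl (≡.trans Av≡Aw Aw≡¬Av)

  covers : ∀ u → Adj G u v ⊎ Adj G u w
  covers u with A u Bool.≟ A v
  ... | yes Au≡Av = inj₂ (across λ Au≡Aw → not-¬ Au≡Av (≡.trans Au≡Aw Aw≡¬Av))
  ... | no Au≢Av = inj₁ (across Au≢Av)

module _ {n} (G : Graph n) (triangleFree : TriangleFree G) where

  complementaryNeighbourhoods : ∀ {v w} → DominatingEdge G v w → ∀ u → adj G u v ≡ not (adj G u w)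
  complementaryNeighbourhoods {v} {w} (v~w , covers) u
    with adj G u v in u~v | adj G u w in u~w | covers u
  ... | true  | true  | _ = contradiction (u~v , v~w , u~w) (triangleFree u v w)
  ... | true  | false | _ = refl
  ... | false | true  | _ = refl
  ... | false | false | inj₁ ()
  ... | false | false | inj₂ ()

  everyVertexOnDominatingEdge⇒completeBipartite : EveryVertexOnDominatingEdge G → Fin n → CompleteBipartite G
  everyVertexOnDominatingEdge⇒completeBipartite edges v₀ =
    A , (v₀ , proj₁ v₀w₀) , (w₀ , irrefl G w₀) , λ u x → mk⇔ adjacent⇒opposite opposite⇒adjacent
    where
    w₀ : Fin n
    w₀ = proj₁ (edges v₀)

    v₀w₀ : DominatingEdge G v₀ w₀
    v₀w₀ = proj₂ (edges v₀)

    A : VSet n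
    A u = adj G u w₀

    outsideA⇒adjacent-v₀ : ∀ {u} → A u ≡ false → Adj G u v₀
    outsideA⇒adjacent-v₀ {u} u≁w₀ =
      ≡.trans (complementaryNeighbourhoods v₀w₀ u) (cong not u≁w₀)

    adjacent⇒opposite : ∀ {u x} → Adj G u x → A u ≢ A x
    adjacent⇒opposite {u} {x} u~x Au≡Ax with adj G u w₀ in u~w₀
    ... | true  = triangleFree u x w₀ (u~x , ≡.sym Au≡Ax , u~w₀)
    ... | false =
      triangleFree u x v₀ (u~x , outsideA⇒adjacent-v₀ (≡.sym Au≡Ax) , outsideA⇒adjacent-v₀ u~w₀)

    opposite⇒adjacent : ∀ {u x} → A u ≢ A x → Adj G u x
    opposite⇒adjacent {u} {x} Au≢Ax =
      Adj-sym G (≡.trans (complementaryNeighbourhoods edge x) (cong not x≁w))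
      where
      w : Fin n
      w = proj₁ (edges u)

      edge : DominatingEdge G u w
      edge = proj₂ (edges u)

      Ax≡Aw : A x ≡ A w
      Ax≡Aw = begin
        A x        ≡⟨ ¬-not (≢-sym Au≢Ax) ⟩
        not (A u)  ≡⟨ ¬-not (adjacent⇒opposite (Adj-sym G (proj₁ edge))) ⟨
        A w        ∎

      x≁w : adj G x w ≡ false
      x≁w = ¬-not λ x~w → adjacent⇒opposite x~w Ax≡Aw

  everyVertexOnDominatingEdge⇔completeBipartite : Fin n →
                                                  EveryVertexOnDominatingEdge G ⇔ CompleteBipartite G
  everyVertexOnDominatingEdge⇔completeBipartite v₀ =
    mk⇔ (λ edges → everyVertexOnDominatingEdge⇒completeBipartite edges v₀)
        (completeBipartite⇒everyVertexOnDominatingEdge G)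

mainTheorem15 : ∀ (n : ℕ) (G : Graph n) → 2 ≤ n → TriangleFree G →
    (PCis G n ⇔ CompleteBipartite G)
mainTheorem15 (suc n) G (s≤s _) triangleFree =
  everyVertexOnDominatingEdge⇔completeBipartite G triangleFree zero
    ⇔-∘ PCis-n⇔everyVertexOnDominatingEdge G
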